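{- For every integer $m\ge 1$, $$\frac{1}{(m+1)!}=\sum_{n=0}^{\infty}\frac{(-1)^n c_n\,(H_{n+m}-H_{m-1})}{(n+m)!}.$$
   Context: The Cauchy numbers are $c_n=\int_0^1 t(t-1)\cdots(t-n+1)\,dt$ (empty product $=1$). Harmonic numbers: $H_0=0$, $H_n=1+\frac12+\cdots+\frac1n$ for $n\ge1$. -}

module Defs where

open import Data.Nat as ℕ using (ℕ; zero; suc; _!; _∸_)
open import Data.Nat.Properties using (_!≢0)
open import Data.Integer as ℤ using (ℤ; +_)
open import Data.Rational using (ℚ; 0ℚ; 1ℚ; _+_; _*_; _-_; -_; _/_; ∣_∣; _<_)
open import Data.List using (List; []; _∷_)
open import Data.Product using (∃-syntax)

-- Polynomials over ℚ as ascending coefficient lists: a₀ ∷ a₁ ∷ ... represents Σ aₖ tᵏ.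
Poly : Set
Poly = List ℚ

scale : ℚ → Poly → Poly
scale c [] = []
scale c (a ∷ p) = c * a ∷ scale c p

addP : Poly → Poly → Poly
addP [] q = q
addP p [] = p
addP (a ∷ p) (b ∷ q) = a + b ∷ addP p q

mulLin : ℚ → Poly → Poly
mulLin c p = addP (0ℚ ∷ p) (scale (- c) p)

fromℕ : ℕ → ℚ
fromℕ k = + k / 1

falling : ℕ → Poly
falling zero = 1ℚ ∷ []
falling (suc n) = mulLin (fromℕ n) (falling n)

-- ∫₀¹ p(t) dt, computed termwise: ∫₀¹ tᵏ dt = 1/(k+1)
integral01From : ℕ → Poly → ℚ
integral01From k [] = 0ℚ
integral01From k (a ∷ p) = a * (+ 1 / suc k) + integral01From (suc k) p

integral01 : Poly → ℚ
integral01 = integral01From 0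

cauchy : ℕ → ℚ
cauchy n = integral01 (falling n)

harmonic : ℕ → ℚ
harmonic zero = 0ℚ
harmonic (suc n) = harmonic n + (+ 1 / suc n)

sign : ℕ → ℚ
sign zero = 1ℚ
sign (suc n) = - sign n

invFact : ℕ → ℚ
invFact k = (+ 1 / (k !)) {{k !≢0}}

term : ℕ → ℕ → ℚ
term m n = sign n * cauchy n * (harmonic (n ℕ.+ m) - harmonic (m ∸ 1)) * invFact (n ℕ.+ m)

partialSum : ℕ → ℕ → ℚ
partialSum m zero = 0ℚ
partialSum m (suc N) = partialSum m N + term m N

-- the series Σ f(n) converges (in ℚ, hence in ℝ) to L
SeriesConvergesTo : (ℕ → ℚ) → ℚ → Set
SeriesConvergesTo s L = ∀ (ε : ℚ) → 0ℚ < ε → ∃[ N ] (∀ n → N ℕ.≤ n → ∣ s n - L ∣ < ε)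

module Submission where

-- Put Rₙ(t) = (-1)ⁿ t(t-1)⋯(t-n+1) and μ n k = ∫₀¹ (1-t)ᵏ Rₙ(t) dt, so that (-1)ⁿ cₙ = μ n 0
-- and μ (n+1) k = (n-1) μ n k + μ n (k+1).  Let α N k be the N-th partial sum with μ n 0
-- replaced by μ n k, and (Δ g)(k) = (m+1) g(k) - g(k+1).  The recursion makes Δ²(α N)
-- telescope in N:  Δ²(α N) = μ 0 / (m-1)! - e N  with an explicit error e N.  Inverting Δ²
-- (Δ⁻² = Σₖ (k+1) r^{k+2} Sᵏ with r = 1/(m+1) and S the shift), truncated after M terms,
-- turns this into an exact formula for α N 0 - 1/(m+1)! whose main part is 1/(m+1)! (1 - rᴹ).
-- The bounds |μ n k| ≤ (n-1)! then give |α N 0 - 1/(m+1)!| ≤ EB N + δ N M for every M, where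
-- δ N M → 0 as M → ∞ and EB N = O(H_N / N) → 0.

open import Defs
open import Data.Nat as ℕ using (ℕ; zero; suc; _!)
import Data.Nat.Properties as ℕP
import Data.Nat.Divisibility as ℕD
open import Data.Nat.Tactic.RingSolver using (solve-∀)
open import Data.Nat.Coprimality as Coprimality using (1-coprimeTo)
open import Data.Integer as ℤ using (+_)
import Data.Integer.Properties as ℤP
import Data.Empty.Irrelevant as Irrelevant
open import Data.Empty using (⊥-elim)
open import Data.Rational
open import Data.Rational.Properties
open import Data.Rational.Solver using (module +-*-Solver)
open +-*-Solver
open import Data.List using ([]; _∷_)
open import Data.Product using (∃-syntax; _,_; proj₁; proj₂)
open import Data.Sum using (inj₁; inj₂)
open import Relation.Nullary using (yes; no)
open import Relation.Binary.PropositionalEquality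
  using (_≡_; refl; sym; trans; cong; cong₂; subst; subst₂; module ≡-Reasoning)

fromℕ-mkℚ : ∀ k → fromℕ k ≡ mkℚ (+ k) 0 (Coprimality.sym (1-coprimeTo k))
fromℕ-mkℚ k = normalize-coprime (Coprimality.sym (1-coprimeTo k))

fromℕ-suc : ∀ n → fromℕ (suc n) ≡ 1ℚ + fromℕ n
fromℕ-suc n = sym (trans (cong (_+_ 1ℚ) (fromℕ-mkℚ n)) (cong (_/ 1) numerator))
  where
  numerator : + 1 ℤ.+ (+ n ℤ.* + 1) ≡ + suc n
  numerator = cong (λ x → + 1 ℤ.+ x) (ℤP.*-identityʳ (+ n))

fromℕ-+ : ∀ a b → fromℕ (a ℕ.+ b) ≡ fromℕ a + fromℕ b
fromℕ-+ zero b = sym (+-identityˡ (fromℕ b))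
fromℕ-+ (suc a) b = begin
  fromℕ (suc (a ℕ.+ b))     ≡⟨ fromℕ-suc (a ℕ.+ b) ⟩
  1ℚ + fromℕ (a ℕ.+ b)      ≡⟨ cong (_+_ 1ℚ) (fromℕ-+ a b) ⟩
  1ℚ + (fromℕ a + fromℕ b)  ≡⟨ sym (+-assoc 1ℚ (fromℕ a) (fromℕ b)) ⟩
  1ℚ + fromℕ a + fromℕ b    ≡⟨ cong (_+ fromℕ b) (sym (fromℕ-suc a)) ⟩
  fromℕ (suc a) + fromℕ b   ∎
  where open ≡-Reasoning

fromℕ-* : ∀ a b → fromℕ (a ℕ.* b) ≡ fromℕ a * fromℕ b
fromℕ-* zero b = sym (*-zeroˡ (fromℕ b))
fromℕ-* (suc a) b = begin
  fromℕ (b ℕ.+ a ℕ.* b)        ≡⟨ fromℕ-+ b (a ℕ.* b) ⟩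
  fromℕ b + fromℕ (a ℕ.* b)    ≡⟨ cong (_+_ (fromℕ b)) (fromℕ-* a b) ⟩
  fromℕ b + fromℕ a * fromℕ b  ≡⟨ solve 2 (λ x y → y :+ x :* y := (con 1ℚ :+ x) :* y) refl (fromℕ a) (fromℕ b) ⟩
  (1ℚ + fromℕ a) * fromℕ b     ≡⟨ cong (_* fromℕ b) (sym (fromℕ-suc a)) ⟩
  fromℕ (suc a) * fromℕ b      ∎
  where open ≡-Reasoning

fromℕ-mono-≤ : ∀ {a b} → a ℕ.≤ b → fromℕ a ≤ fromℕ b
fromℕ-mono-≤ {a} {b} a≤b = subst₂ _≤_ (sym (fromℕ-mkℚ a)) (sym (fromℕ-mkℚ b))
  (*≤* (subst₂ ℤ._≤_ (sym (ℤP.*-identityʳ (+ a))) (sym (ℤP.*-identityʳ (+ b))) (ℤ.+≤+ a≤b)))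

fromℕ-mono-< : ∀ {a b} → a ℕ.< b → fromℕ a < fromℕ b
fromℕ-mono-< {a} {b} a<b = subst₂ _<_ (sym (fromℕ-mkℚ a)) (sym (fromℕ-mkℚ b))
  (*<* (subst₂ ℤ._<_ (sym (ℤP.*-identityʳ (+ a))) (sym (ℤP.*-identityʳ (+ b))) (ℤ.+<+ a<b)))

fromℕ-nonneg : ∀ a → 0ℚ ≤ fromℕ a
fromℕ-nonneg a = fromℕ-mono-≤ {0} {a} ℕ.z≤n

*-monoʳ-≤ : ∀ {p q} r → 0ℚ ≤ r → p ≤ q → p * r ≤ q * r
*-monoʳ-≤ r 0≤r = *-monoʳ-≤-nonNeg r {{nonNegative 0≤r}}

*-monoˡ-≤ : ∀ {p q} r → 0ℚ ≤ r → p ≤ q → r * p ≤ r * q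
*-monoˡ-≤ r 0≤r = *-monoˡ-≤-nonNeg r {{nonNegative 0≤r}}

*-mono-≤ : ∀ {p q c d} → 0ℚ ≤ p → 0ℚ ≤ c → p ≤ q → c ≤ d → p * c ≤ q * d
*-mono-≤ {p} {q} {c} {d} 0≤p 0≤c p≤q c≤d =
  ≤-trans (*-monoʳ-≤ c 0≤c p≤q) (*-monoˡ-≤ q (≤-trans 0≤p p≤q) c≤d)

*-nonneg : ∀ {p q} → 0ℚ ≤ p → 0ℚ ≤ q → 0ℚ ≤ p * q
*-nonneg {p} {q} 0≤p 0≤q = subst (_≤ p * q) (*-zeroˡ q) (*-monoʳ-≤ q 0≤q 0≤p)

+-nonneg : ∀ {p q} → 0ℚ ≤ p → 0ℚ ≤ q → 0ℚ ≤ p + q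
+-nonneg = +-mono-≤

p≤p+q : ∀ x {y} → 0ℚ ≤ y → x ≤ x + y
p≤p+q x {y} 0≤y = subst (_≤ x + y) (+-identityʳ x) (+-monoʳ-≤ x 0≤y)

p-q≤p : ∀ x {y} → 0ℚ ≤ y → x - y ≤ x
p-q≤p x {y} 0≤y = subst (x - y ≤_) (+-identityʳ x) (+-monoʳ-≤ x (neg-antimono-≤ 0≤y))

q≤p⇒0≤p-q : ∀ {x y} → y ≤ x → 0ℚ ≤ x - y
q≤p⇒0≤p-q {x} {y} y≤x = subst (_≤ x - y) (+-inverseʳ y) (+-monoˡ-≤ (- y) y≤x)

inv : (n : ℕ) → .{{ℕ.NonZero n}} → ℚ
inv n = + 1 / n

fromℕ*inv : ∀ n .{{_ : ℕ.NonZero n}} → fromℕ n * inv n ≡ 1ℚ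
fromℕ*inv zero {{n≢0}} = Irrelevant.⊥-elim (ℕ.NonZero.nonZero n≢0)
fromℕ*inv (suc k) =
  trans (cong₂ _*_ (fromℕ-mkℚ (suc k)) (normalize-coprime (1-coprimeTo (suc k))))
        (*-inverseʳ (mkℚ (+ suc k) 0 (Coprimality.sym (1-coprimeTo (suc k)))))

inverse-unique : ∀ a x y → a * x ≡ 1ℚ → a * y ≡ 1ℚ → x ≡ y
inverse-unique a x y ax≡1 ay≡1 = begin
  x              ≡⟨ sym (*-identityʳ x) ⟩
  x * 1ℚ         ≡⟨ cong (x *_) (sym ay≡1) ⟩
  x * (a * y)    ≡⟨ solve 3 (λ x a y → x :* (a :* y) := (a :* x) :* y) refl x a y ⟩
  (a * x) * y    ≡⟨ cong (_* y) ax≡1 ⟩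
  1ℚ * y         ≡⟨ *-identityˡ y ⟩
  y              ∎
  where open ≡-Reasoning

inv-* : ∀ a b .{{_ : ℕ.NonZero a}} .{{_ : ℕ.NonZero b}} →
        inv (a ℕ.* b) {{ℕP.m*n≢0 a b}} ≡ inv a * inv b
inv-* a b = inverse-unique (fromℕ (a ℕ.* b)) _ _ (fromℕ*inv (a ℕ.* b) {{ℕP.m*n≢0 a b}}) product
  where
  open ≡-Reasoning
  product : fromℕ (a ℕ.* b) * (inv a * inv b) ≡ 1ℚ
  product = begin
    fromℕ (a ℕ.* b) * (inv a * inv b)      ≡⟨ cong (_* (inv a * inv b)) (fromℕ-* a b) ⟩
    fromℕ a * fromℕ b * (inv a * inv b)    ≡⟨ solve 4 (λ A B x y → A :* B :* (x :* y) := (A :* x) :* (B :* y)) refl (fromℕ a) (fromℕ b) (inv a) (inv b) ⟩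
    (fromℕ a * inv a) * (fromℕ b * inv b)  ≡⟨ cong₂ _*_ (fromℕ*inv a) (fromℕ*inv b) ⟩
    1ℚ * 1ℚ                                ≡⟨⟩
    1ℚ                                     ∎

factorial-mono : ∀ {a b} → a ℕ.≤ b → a ! ℕ.≤ b !
factorial-mono {a} {b} a≤b = ℕD.∣⇒≤ {{b ℕP.!≢0}} (ℕD.m≤n⇒m!∣n! a≤b)

fact*invFact : ∀ k → fromℕ (k !) * invFact k ≡ 1ℚ
fact*invFact k = fromℕ*inv (k !) {{k ℕP.!≢0}}

invFact-suc : ∀ k → invFact k ≡ fromℕ (suc k) * invFact (suc k)
invFact-suc k = inverse-unique (fromℕ (k !)) _ _ (fact*invFact k) shifted
  where
  open ≡-Reasoning
  shifted : fromℕ (k !) * (fromℕ (suc k) * invFact (suc k)) ≡ 1ℚ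
  shifted = begin
    fromℕ (k !) * (fromℕ (suc k) * invFact (suc k))  ≡⟨ sym (*-assoc (fromℕ (k !)) _ _) ⟩
    fromℕ (k !) * fromℕ (suc k) * invFact (suc k)    ≡⟨ cong (_* invFact (suc k)) (sym (fromℕ-* (k !) (suc k))) ⟩
    fromℕ (k ! ℕ.* suc k) * invFact (suc k)          ≡⟨ cong (λ n → fromℕ n * invFact (suc k)) (ℕP.*-comm (k !) (suc k)) ⟩
    fromℕ (suc k !) * invFact (suc k)                ≡⟨ fact*invFact (suc k) ⟩
    1ℚ                                               ∎

fact*invFact-suc : ∀ k → fromℕ (k !) * invFact (suc k) ≡ inv (suc k)
fact*invFact-suc k = inverse-unique (fromℕ (suc k)) _ _ cancelled (fromℕ*inv (suc k))
  where
  open ≡-Reasoning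
  cancelled : fromℕ (suc k) * (fromℕ (k !) * invFact (suc k)) ≡ 1ℚ
  cancelled = begin
    fromℕ (suc k) * (fromℕ (k !) * invFact (suc k))  ≡⟨ sym (*-assoc (fromℕ (suc k)) _ _) ⟩
    fromℕ (suc k) * fromℕ (k !) * invFact (suc k)    ≡⟨ cong (_* invFact (suc k)) (sym (fromℕ-* (suc k) (k !))) ⟩
    fromℕ (suc k !) * invFact (suc k)                ≡⟨ fact*invFact (suc k) ⟩
    1ℚ                                               ∎

inv-pos : ∀ n .{{_ : ℕ.NonZero n}} → 0ℚ < inv n
inv-pos zero {{n≢0}} = Irrelevant.⊥-elim (ℕ.NonZero.nonZero n≢0)
inv-pos (suc k) = subst (0ℚ <_) (sym (normalize-coprime (1-coprimeTo (suc k)))) (positive⁻¹ (mkℚ (+ 1) k _))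

inv-nonneg : ∀ n .{{_ : ℕ.NonZero n}} → 0ℚ ≤ inv n
inv-nonneg n = <⇒≤ (inv-pos n)

invFact-nonneg : ∀ k → 0ℚ ≤ invFact k
invFact-nonneg k = inv-nonneg (k !) {{k ℕP.!≢0}}

fraction-rescale : ∀ a b d .{{_ : ℕ.NonZero b}} .{{_ : ℕ.NonZero d}} →
                   fromℕ a * inv b ≡ fromℕ (a ℕ.* d) * (inv b * inv d)
fraction-rescale a b d = begin
  fromℕ a * inv b                        ≡⟨ sym (*-identityʳ _) ⟩
  fromℕ a * inv b * 1ℚ                   ≡⟨ cong (fromℕ a * inv b *_) (sym (fromℕ*inv d)) ⟩
  fromℕ a * inv b * (fromℕ d * inv d)    ≡⟨ solve 4 (λ A x D y → A :* x :* (D :* y) := A :* D :* (x :* y)) refl (fromℕ a) (inv b) (fromℕ d) (inv d) ⟩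
  fromℕ a * fromℕ d * (inv b * inv d)    ≡⟨ cong (_* (inv b * inv d)) (sym (fromℕ-* a d)) ⟩
  fromℕ (a ℕ.* d) * (inv b * inv d)      ∎
  where open ≡-Reasoning

fraction-≤ : ∀ a b c d .{{_ : ℕ.NonZero b}} .{{_ : ℕ.NonZero d}} →
             a ℕ.* d ℕ.≤ c ℕ.* b → fromℕ a * inv b ≤ fromℕ c * inv d
fraction-≤ a b c d ad≤cb =
  subst₂ _≤_ (sym (fraction-rescale a b d))
             (trans (cong (fromℕ (c ℕ.* b) *_) (*-comm (inv b) (inv d))) (sym (fraction-rescale c d b)))
         (*-monoʳ-≤ (inv b * inv d) (*-nonneg (inv-nonneg b) (inv-nonneg d)) (fromℕ-mono-≤ ad≤cb))

fraction-< : ∀ a b c d .{{_ : ℕ.NonZero b}} .{{_ : ℕ.NonZero d}} →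
             a ℕ.* d ℕ.< c ℕ.* b → fromℕ a * inv b < fromℕ c * inv d
fraction-< a b c d ad<cb =
  subst₂ _<_ (sym (fraction-rescale a b d))
             (trans (cong (fromℕ (c ℕ.* b) *_) (*-comm (inv b) (inv d))) (sym (fraction-rescale c d b)))
         (*-monoˡ-<-pos (inv b * inv d) {{positive 0<bd}} (fromℕ-mono-< ad<cb))
  where
  0<bd : 0ℚ < inv b * inv d
  0<bd = subst (_< inv b * inv d) (*-zeroˡ (inv d)) (*-monoˡ-<-pos (inv d) {{positive (inv-pos d)}} (inv-pos b))

inv-antitone : ∀ {a b} .{{_ : ℕ.NonZero a}} .{{_ : ℕ.NonZero b}} → a ℕ.≤ b → inv b ≤ inv a
inv-antitone {a} {b} a≤b = subst₂ _≤_ (*-identityˡ (inv b)) (*-identityˡ (inv a))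
  (fraction-≤ 1 b 1 a (subst₂ ℕ._≤_ (sym (ℕP.*-identityˡ a)) (sym (ℕP.*-identityˡ b)) a≤b))

inv-≤1 : ∀ k → inv (suc k) ≤ 1ℚ
inv-≤1 k = inv-antitone {1} {suc k} (ℕ.s≤s ℕ.z≤n)

inv-half : ∀ a .{{_ : ℕ.NonZero a}} → inv (2 ℕ.* a) {{ℕP.m*n≢0 2 a}} + inv (2 ℕ.* a) {{ℕP.m*n≢0 2 a}} ≡ inv a
inv-half a = begin
  inv (2 ℕ.* a) {{ℕP.m*n≢0 2 a}} + inv (2 ℕ.* a) {{ℕP.m*n≢0 2 a}} ≡⟨ cong₂ _+_ (inv-* 2 a) (inv-* 2 a) ⟩
  ½ * inv a + ½ * inv a  ≡⟨ solve 1 (λ x → con ½ :* x :+ con ½ :* x := x) refl (inv a) ⟩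
  inv a                  ∎
  where open ≡-Reasoning

natural-above : ∀ x → ∃[ C ] x ≤ fromℕ C
natural-above (mkℚ (+ n) d c) = n , subst (mkℚ (+ n) d c ≤_) (sym (fromℕ-mkℚ n))
  (*≤* (ℤP.*-monoˡ-≤-nonNeg (+ n) (ℤ.+≤+ (ℕ.s≤s ℕ.z≤n))))
natural-above (mkℚ ℤ.-[1+ n ] d c) = 0 , <⇒≤ (negative⁻¹ (mkℚ ℤ.-[1+ n ] d c))

unit-fraction-≤ : ∀ ε → 0ℚ < ε → ∃[ d ] inv (suc d) ≤ ε
unit-fraction-≤ (mkℚ ℤ.+[1+ p ] d c) _ = d , subst (_≤ mkℚ ℤ.+[1+ p ] d c) (sym (normalize-coprime (1-coprimeTo (suc d))))
  (*≤* (ℤP.*-monoʳ-≤-nonNeg (+ suc d) (ℤ.+≤+ {1} {suc p} (ℕ.s≤s ℕ.z≤n))))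
unit-fraction-≤ (mkℚ (+ 0) d c) (*<* (ℤ.+<+ ()))
unit-fraction-≤ (mkℚ ℤ.-[1+ p ] d c) 0<ε = ⊥-elim (<-asym 0<ε (negative⁻¹ (mkℚ ℤ.-[1+ p ] d c)))

unit-fraction-< : ∀ ε → 0ℚ < ε → ∃[ d ] inv (suc d) < ε
unit-fraction-< ε 0<ε with unit-fraction-≤ ε 0<ε
... | d , 1/d+1≤ε = suc d , <-≤-trans shrink 1/d+1≤ε
  where
  shrink : inv (suc (suc d)) < inv (suc d)
  shrink = subst₂ _<_ (*-identityˡ _) (*-identityˡ _)
    (fraction-< 1 (suc (suc d)) 1 (suc d) (subst₂ ℕ._<_ (sym (ℕP.*-identityˡ _)) (sym (ℕP.*-identityˡ _)) ℕP.≤-refl))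

∣scale∣-≤ : ∀ {a x B} → 0ℚ ≤ a → ∣ x ∣ ≤ B → ∣ a * x ∣ ≤ a * B
∣scale∣-≤ {a} {x} {B} 0≤a ∣x∣≤B =
  subst (_≤ a * B) (sym (trans (∣p*q∣≡∣p∣*∣q∣ a x) (cong (_* ∣ x ∣) (0≤p⇒∣p∣≡p 0≤a))))
        (*-monoˡ-≤ a 0≤a ∣x∣≤B)

∣+∣-≤ : ∀ {x y A B} → ∣ x ∣ ≤ A → ∣ y ∣ ≤ B → ∣ x + y ∣ ≤ A + B
∣+∣-≤ {x} {y} ∣x∣≤A ∣y∣≤B = ≤-trans (∣p+q∣≤∣p∣+∣q∣ x y) (+-mono-≤ ∣x∣≤A ∣y∣≤B)

∣-∣-≤ : ∀ {x y A B} → ∣ x ∣ ≤ A → ∣ y ∣ ≤ B → ∣ x - y ∣ ≤ A + B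
∣-∣-≤ {x} {y} ∣x∣≤A ∣y∣≤B = ≤-trans (∣p-q∣≤∣p∣+∣q∣ x y) (+-mono-≤ ∣x∣≤A ∣y∣≤B)

∣-∣-unit : ∀ {x y} → 0ℚ ≤ x → x ≤ 1ℚ → 0ℚ ≤ y → y ≤ 1ℚ → ∣ y - x ∣ ≤ 1ℚ
∣-∣-unit {x} {y} 0≤x x≤1 0≤y y≤1 with ∣p∣≡p∨∣p∣≡-p (y - x)
... | inj₁ ∣d∣≡d = subst (_≤ 1ℚ) (sym ∣d∣≡d) (≤-trans (p-q≤p y 0≤x) y≤1)
... | inj₂ ∣d∣≡-d = subst (_≤ 1ℚ) (sym (trans ∣d∣≡-d (solve 2 (λ y x → :- (y :- x) := x :- y) refl y x)))
                          (≤-trans (p-q≤p x 0≤y) x≤1)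

-- integral01From k p = ∫₀¹ tᵏ p(t) dt is linear in p, and multiplying p by (t - c)
-- raises the weight tᵏ to tᵏ⁺¹ on one summand.

integral-addP : ∀ k p q → integral01From k (addP p q) ≡ integral01From k p + integral01From k q
integral-addP k [] q = sym (+-identityˡ _)
integral-addP k (a ∷ p) [] = sym (+-identityʳ _)
integral-addP k (a ∷ p) (b ∷ q) = begin
  (a + b) * w + I (addP p q)    ≡⟨ cong (λ x → (a + b) * w + x) (integral-addP (suc k) p q) ⟩
  (a + b) * w + (I p + I q)     ≡⟨ solve 5 (λ a b w x y → (a :+ b) :* w :+ (x :+ y) := (a :* w :+ x) :+ (b :* w :+ y)) refl a b w (I p) (I q) ⟩
  (a * w + I p) + (b * w + I q) ∎
  where
  open ≡-Reasoning
  w : ℚ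
  I : Poly → ℚ
  w = + 1 / suc k
  I = integral01From (suc k)

integral-scale : ∀ k c p → integral01From k (scale c p) ≡ c * integral01From k p
integral-scale k c [] = sym (*-zeroʳ c)
integral-scale k c (a ∷ p) = begin
  c * a * w + I (scale c p)  ≡⟨ cong (λ x → c * a * w + x) (integral-scale (suc k) c p) ⟩
  c * a * w + c * I p        ≡⟨ solve 4 (λ c a w x → c :* a :* w :+ c :* x := c :* (a :* w :+ x)) refl c a w (I p) ⟩
  c * (a * w + I p)          ∎
  where
  open ≡-Reasoning
  w : ℚ
  I : Poly → ℚ
  w = + 1 / suc k
  I = integral01From (suc k)

integral-mulLin : ∀ k c p → integral01From k (mulLin c p) ≡ integral01From (suc k) p - c * integral01From k p
integral-mulLin k c p = begin
  integral01From k (addP (0ℚ ∷ p) (scale (- c) p))           ≡⟨ integral-addP k (0ℚ ∷ p) (scale (- c) p) ⟩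
  (0ℚ * w + I₊ p) + integral01From k (scale (- c) p)         ≡⟨ cong (λ x → (0ℚ * w + I₊ p) + x) (integral-scale k (- c) p) ⟩
  (0ℚ * w + I₊ p) + (- c) * integral01From k p               ≡⟨ solve 4 (λ w x c y → (con 0ℚ :* w :+ x) :+ (:- c) :* y := x :- c :* y) refl w (I₊ p) c (integral01From k p) ⟩
  I₊ p - c * integral01From k p                              ∎
  where
  open ≡-Reasoning
  w : ℚ
  I₊ : Poly → ℚ
  w = + 1 / suc k
  I₊ = integral01From (suc k)

fallingMoment : ℕ → ℕ → ℚ
fallingMoment n k = integral01From k (falling n)

fallingMoment-suc : ∀ n k → fallingMoment (suc n) k ≡ fallingMoment n (suc k) - fromℕ n * fallingMoment n k
fallingMoment-suc n k = integral-mulLin k (fromℕ n) (falling n)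

-- The Beta integral β i j = ∫₀¹ tⁱ (1-t)ʲ dt = i! j! / (i+j+1)!.  Only its boundary values and
-- the relation (1-t)ʲ⁺¹ = (1-t)ʲ - t(1-t)ʲ are used.

β : ℕ → ℕ → ℚ
β i j = fromℕ (i ! ℕ.* j !) * invFact (suc (i ℕ.+ j))

β-zeroʳ : ∀ i → β i 0 ≡ inv (suc i)
β-zeroʳ i = trans (cong₂ (λ a b → fromℕ a * invFact (suc b)) (ℕP.*-identityʳ (i !)) (ℕP.+-identityʳ i))
                  (fact*invFact-suc i)

β-zeroˡ : ∀ j → β 0 j ≡ inv (suc j)
β-zeroˡ j = trans (cong (λ a → fromℕ a * invFact (suc j)) (ℕP.+-identityʳ (j !))) (fact*invFact-suc j)

β-suc : ∀ i j → β i (suc j) ≡ β i j - β (suc i) j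
β-suc i j = begin
  fromℕ (i ! ℕ.* (suc j ℕ.* j !)) * invFact (suc (i ℕ.+ suc j))
    ≡⟨ cong₂ _*_ (trans (fromℕ-* (i !) (suc j ℕ.* j !)) (cong (A *_) (trans (fromℕ-* (suc j) (j !)) (cong (_* B) (fromℕ-suc j)))))
                 (cong (λ x → invFact (suc x)) (ℕP.+-suc i j)) ⟩
  A * ((1ℚ + nj) * B) * T
    ≡⟨ solve 5 (λ A B T ni nj → A :* ((con 1ℚ :+ nj) :* B) :* T
                               := A :* B :* ((con 1ℚ :+ (con 1ℚ :+ (ni :+ nj))) :* T) :- (con 1ℚ :+ ni) :* A :* B :* T)
             refl A B T ni nj ⟩
  A * B * ((1ℚ + (1ℚ + (ni + nj))) * T) - (1ℚ + ni) * A * B * T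
    ≡⟨ cong₂ _-_ (sym (cong₂ _*_ (fromℕ-* (i !) (j !)) invFact-i+j)) (sym β-suc-i) ⟩
  β i j - β (suc i) j ∎
  where
  open ≡-Reasoning
  A B T ni nj : ℚ
  A = fromℕ (i !)
  B = fromℕ (j !)
  T = invFact (suc (suc (i ℕ.+ j)))
  ni = fromℕ i
  nj = fromℕ j
  invFact-i+j : invFact (suc (i ℕ.+ j)) ≡ (1ℚ + (1ℚ + (ni + nj))) * T
  invFact-i+j = trans (invFact-suc (suc (i ℕ.+ j)))
    (cong (_* T) (trans (fromℕ-suc (suc (i ℕ.+ j))) (cong (_+_ 1ℚ) (trans (fromℕ-suc (i ℕ.+ j)) (cong (_+_ 1ℚ) (fromℕ-+ i j))))))
  β-suc-i : β (suc i) j ≡ (1ℚ + ni) * A * B * T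
  β-suc-i = cong (_* T) (trans (fromℕ-* (suc i ℕ.* i !) (j !))
                               (cong (_* B) (trans (fromℕ-* (suc i) (i !)) (cong (_* A) (fromℕ-suc i)))))

-- ω n i j = ∫₀¹ tⁱ (1-t)ʲ Rₙ(t) dt  with  R₀ = 1,  Rₙ₊₁(t) = (n - t) Rₙ(t),
-- i.e. Rₙ = (-1)ⁿ t(t-1)⋯(t-n+1).

ω : ℕ → ℕ → ℕ → ℚ
ω zero i j = β i j
ω (suc n) i j = fromℕ n * ω n i j - ω n (suc i) j

-- (1-t)ʲ⁺¹ = (1-t)ʲ - t (1-t)ʲ
ω-suc-j : ∀ n i j → ω n i (suc j) ≡ ω n i j - ω n (suc i) j
ω-suc-j zero i j = β-suc i j
ω-suc-j (suc n) i j = begin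
  fromℕ n * ω n i (suc j) - ω n (suc i) (suc j)  ≡⟨ cong₂ (λ x y → fromℕ n * x - y) (ω-suc-j n i j) (ω-suc-j n (suc i) j) ⟩
  fromℕ n * (a - b) - (b - c)                    ≡⟨ solve 4 (λ N a b c → N :* (a :- b) :- (b :- c) := (N :* a :- b) :- (N :* b :- c)) refl (fromℕ n) a b c ⟩
  (fromℕ n * a - b) - (fromℕ n * b - c)          ∎
  where
  open ≡-Reasoning
  a b c : ℚ
  a = ω n i j
  b = ω n (suc i) j
  c = ω n (suc (suc i)) j

ω-zero-j : ∀ n i → ω n i 0 ≡ sign n * fallingMoment n i
ω-zero-j zero i = trans (β-zeroʳ i) (solve 1 (λ x → x := con 1ℚ :* (con 1ℚ :* x :+ con 0ℚ)) refl (inv (suc i)))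
ω-zero-j (suc n) i = begin
  fromℕ n * ω n i 0 - ω n (suc i) 0                      ≡⟨ cong₂ (λ x y → fromℕ n * x - y) (ω-zero-j n i) (ω-zero-j n (suc i)) ⟩
  fromℕ n * (s * λᵢ) - s * λᵢ₊₁                           ≡⟨ solve 4 (λ N s x y → N :* (s :* x) :- s :* y := (:- s) :* (y :- N :* x)) refl (fromℕ n) s λᵢ λᵢ₊₁ ⟩
  (- s) * (λᵢ₊₁ - fromℕ n * λᵢ)                           ≡⟨ cong ((- s) *_) (sym (fallingMoment-suc n i)) ⟩
  (- s) * fallingMoment (suc n) i                         ∎
  where
  open ≡-Reasoning
  s λᵢ λᵢ₊₁ : ℚ
  s = sign n
  λᵢ = fallingMoment n i
  λᵢ₊₁ = fallingMoment n (suc i)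

-- μ n k = ∫₀¹ (1-t)ᵏ Rₙ(t) dt.  The theorem only involves μ n 0 = (-1)ⁿ cₙ, but the
-- recursion in n mixes in all k.

μ : ℕ → ℕ → ℚ
μ n k = ω n 0 k

sign*cauchy : ∀ n → sign n * cauchy n ≡ μ n 0
sign*cauchy n = sym (ω-zero-j n 0)

μ-zero : ∀ k → μ 0 k ≡ inv (suc k)
μ-zero = β-zeroˡ

-- Rₙ₊₁(t) = (n - 1) Rₙ(t) + (1 - t) Rₙ(t)
μ-suc : ∀ n k → μ (suc n) k ≡ (fromℕ n - 1ℚ) * μ n k + μ n (suc k)
μ-suc n k = begin
  fromℕ n * ω n 0 k - ω n 1 k                       ≡⟨ solve 3 (λ N a b → N :* a :- b := (N :- con 1ℚ) :* a :+ (a :- b)) refl (fromℕ n) (ω n 0 k) (ω n 1 k) ⟩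
  (fromℕ n - 1ℚ) * ω n 0 k + (ω n 0 k - ω n 1 k)    ≡⟨ cong (λ x → (fromℕ n - 1ℚ) * ω n 0 k + x) (sym (ω-suc-j n 0 k)) ⟩
  (fromℕ n - 1ℚ) * μ n k + μ n (suc k)              ∎
  where open ≡-Reasoning

sumTo : (ℕ → ℚ) → ℕ → ℚ
sumTo g zero = 0ℚ
sumTo g (suc M) = sumTo g M + g M

sumTo-cong : ∀ {g g' : ℕ → ℚ} → (∀ k → g k ≡ g' k) → ∀ M → sumTo g M ≡ sumTo g' M
sumTo-cong g≡g' zero = refl
sumTo-cong g≡g' (suc M) = cong₂ _+_ (sumTo-cong g≡g' M) (g≡g' M)

sumTo-sub : ∀ (g g' : ℕ → ℚ) M → sumTo (λ k → g k - g' k) M ≡ sumTo g M - sumTo g' M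
sumTo-sub g g' zero = refl
sumTo-sub g g' (suc M) = begin
  sumTo (λ k → g k - g' k) M + (g M - g' M)  ≡⟨ cong (_+ (g M - g' M)) (sumTo-sub g g' M) ⟩
  (S - S') + (g M - g' M)                    ≡⟨ solve 4 (λ a b c d → (a :- b) :+ (c :- d) := (a :+ c) :- (b :+ d)) refl S S' (g M) (g' M) ⟩
  (S + g M) - (S' + g' M)                    ∎
  where
  open ≡-Reasoning
  S S' : ℚ
  S = sumTo g M
  S' = sumTo g' M

sumTo-*ʳ : ∀ (g : ℕ → ℚ) a M → sumTo (λ k → g k * a) M ≡ sumTo g M * a
sumTo-*ʳ g a zero = sym (*-zeroˡ a)
sumTo-*ʳ g a (suc M) = trans (cong (_+ g M * a) (sumTo-*ʳ g a M)) (sym (*-distribʳ-+ a (sumTo g M) (g M)))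

sumTo-telescope : ∀ (a : ℕ → ℚ) M → sumTo (λ k → a k - a (suc k)) M ≡ a 0 - a M
sumTo-telescope a zero = sym (+-inverseʳ (a 0))
sumTo-telescope a (suc M) = begin
  sumTo (λ k → a k - a (suc k)) M + (a M - a (suc M))  ≡⟨ cong (_+ (a M - a (suc M))) (sumTo-telescope a M) ⟩
  (a 0 - a M) + (a M - a (suc M))                      ≡⟨ solve 3 (λ x y w → (x :- y) :+ (y :- w) := x :- w) refl (a 0) (a M) (a (suc M)) ⟩
  a 0 - a (suc M)                                      ∎
  where open ≡-Reasoning

sumTo-nonneg : ∀ {g : ℕ → ℚ} → (∀ k → 0ℚ ≤ g k) → ∀ M → 0ℚ ≤ sumTo g M
sumTo-nonneg 0≤g zero = ≤-refl
sumTo-nonneg 0≤g (suc M) = +-nonneg (sumTo-nonneg 0≤g M) (0≤g M)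

sumTo-weighted-≤ : ∀ {q x : ℕ → ℚ} {B} → (∀ k → 0ℚ ≤ q k) → (∀ k → ∣ x k ∣ ≤ B) →
                   ∀ M → ∣ sumTo (λ k → q k * x k) M ∣ ≤ sumTo q M * B
sumTo-weighted-≤ {B = B} 0≤q ∣x∣≤B zero = ≤-reflexive (sym (*-zeroˡ B))
sumTo-weighted-≤ {q} {x} {B} 0≤q ∣x∣≤B (suc M) = begin
  ∣ sumTo (λ k → q k * x k) M + q M * x M ∣      ≤⟨ ∣p+q∣≤∣p∣+∣q∣ (sumTo (λ k → q k * x k) M) (q M * x M) ⟩
  ∣ sumTo (λ k → q k * x k) M ∣ + ∣ q M * x M ∣  ≤⟨ +-mono-≤ (sumTo-weighted-≤ 0≤q ∣x∣≤B M) (∣scale∣-≤ (0≤q M) (∣x∣≤B M)) ⟩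
  sumTo q M * B + q M * B                        ≡⟨ sym (*-distribʳ-+ B (sumTo q M) (q M)) ⟩
  (sumTo q M + q M) * B                          ∎
  where open ≤-Reasoning

pow : ℚ → ℕ → ℚ
pow r zero = 1ℚ
pow r (suc n) = pow r n * r

pow-nonneg : ∀ {r} → 0ℚ ≤ r → ∀ n → 0ℚ ≤ pow r n
pow-nonneg 0≤r zero = inv-nonneg 1
pow-nonneg 0≤r (suc n) = *-nonneg (pow-nonneg 0≤r n) 0≤r

pow-≤-half^ : ∀ {r} → 0ℚ ≤ r → r ≤ ½ → ∀ n → pow r n ≤ inv (2 ℕ.^ n) {{ℕP.m^n≢0 2 n}}
pow-≤-half^ 0≤r r≤½ zero = ≤-refl
pow-≤-half^ {r} 0≤r r≤½ (suc n) = begin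
  pow r n * r                                       ≤⟨ *-mono-≤ (pow-nonneg 0≤r n) 0≤r (pow-≤-half^ 0≤r r≤½ n) r≤½ ⟩
  inv (2 ℕ.^ n) {{ℕP.m^n≢0 2 n}} * ½                 ≡⟨ *-comm (inv (2 ℕ.^ n) {{ℕP.m^n≢0 2 n}}) ½ ⟩
  ½ * inv (2 ℕ.^ n) {{ℕP.m^n≢0 2 n}}                 ≡⟨ sym (inv-* 2 (2 ℕ.^ n) {{_}} {{ℕP.m^n≢0 2 n}}) ⟩
  inv (2 ℕ.^ suc n) {{ℕP.m^n≢0 2 (suc n)}}           ∎
  where open ≤-Reasoning

pow-shift-≤ : ∀ {r} → 0ℚ ≤ r → r ≤ 1ℚ → ∀ M → fromℕ M * pow r (suc M) ≤ fromℕ (suc M) * pow r M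
pow-shift-≤ {r} 0≤r r≤1 M =
  *-mono-≤ (fromℕ-nonneg M) (pow-nonneg 0≤r (suc M)) (fromℕ-mono-≤ (ℕP.n≤1+n M))
           (subst (pow r M * r ≤_) (*-identityʳ (pow r M)) (*-monoˡ-≤ (pow r M) (pow-nonneg 0≤r M) r≤1))

n<2^n : ∀ n → n ℕ.< 2 ℕ.^ n
n<2^n zero = ℕ.s≤s ℕ.z≤n
n<2^n (suc n) = ℕP.+-mono-≤ (ℕP.m^n>0 2 n) (ℕP.≤-trans (n<2^n n) (ℕP.m≤m+n (2 ℕ.^ n) 0))

exponential-beats-linear : ∀ X → ∃[ M ] suc M ℕ.* X ℕ.≤ 2 ℕ.^ M
exponential-beats-linear X = t ℕ.+ t , (begin
  suc (t ℕ.+ t) ℕ.* X    ≡⟨ expand ⟩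
  X ℕ.+ t ℕ.* t          ≤⟨ ℕP.+-monoˡ-≤ (t ℕ.* t) (ℕP.m≤m+n X X) ⟩
  suc t ℕ.* t            ≤⟨ ℕP.*-monoʳ-≤ (suc t) (ℕP.<⇒≤ (n<2^n t)) ⟩
  suc t ℕ.* 2 ℕ.^ t      ≤⟨ ℕP.*-monoˡ-≤ (2 ℕ.^ t) (n<2^n t) ⟩
  2 ℕ.^ t ℕ.* 2 ℕ.^ t    ≡⟨ sym (ℕP.^-distribˡ-+-* 2 t t) ⟩
  2 ℕ.^ (t ℕ.+ t)        ∎)
  where
  open ℕP.≤-Reasoning
  t : ℕ
  t = X ℕ.+ X
  expand : suc (t ℕ.+ t) ℕ.* X ≡ X ℕ.+ t ℕ.* t
  expand = distribute X
    where
    distribute : ∀ x → suc ((x ℕ.+ x) ℕ.+ (x ℕ.+ x)) ℕ.* x ≡ x ℕ.+ (x ℕ.+ x) ℕ.* (x ℕ.+ x)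
    distribute = solve-∀

TendsToZero : (ℕ → ℚ) → Set
TendsToZero a = ∀ D → .{{_ : ℕ.NonZero D}} → ∃[ N ] (∀ n → N ℕ.≤ n → a n ≤ inv D)

ArbitrarilySmall : (ℕ → ℚ) → Set
ArbitrarilySmall b = ∀ D → .{{_ : ℕ.NonZero D}} → ∃[ M ] b M ≤ inv D

-- (M+1) rᴹ W can be made arbitrarily small when 0 ≤ r ≤ ½: polynomial growth loses
-- against 2ᴹ.
linear*geometric-small : ∀ {r W} → 0ℚ ≤ r → r ≤ ½ → 0ℚ ≤ W →
                         ArbitrarilySmall (λ M → fromℕ (suc M) * pow r M * W)
linear*geometric-small {r} {W} 0≤r r≤½ 0≤W D with natural-above W
... | C , W≤C with exponential-beats-linear (C ℕ.* D)
...   | M , growth = M , (begin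
  fromℕ (suc M) * pow r M * W      ≤⟨ *-mono-≤ (*-nonneg (fromℕ-nonneg (suc M)) (pow-nonneg 0≤r M)) 0≤W
                                         (*-monoˡ-≤ (fromℕ (suc M)) (fromℕ-nonneg (suc M)) (pow-≤-half^ 0≤r r≤½ M)) W≤C ⟩
  fromℕ (suc M) * i * fromℕ C      ≡⟨ solve 3 (λ a b c → a :* b :* c := a :* c :* b) refl (fromℕ (suc M)) i (fromℕ C) ⟩
  fromℕ (suc M) * fromℕ C * i      ≡⟨ cong (_* i) (sym (fromℕ-* (suc M) C)) ⟩
  fromℕ (suc M ℕ.* C) * i          ≤⟨ fraction-≤ (suc M ℕ.* C) (2 ℕ.^ M) 1 D {{ℕP.m^n≢0 2 M}} cross ⟩
  fromℕ 1 * inv D                  ≡⟨ *-identityˡ (inv D) ⟩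
  inv D                            ∎)
  where
  open ≤-Reasoning
  i : ℚ
  i = inv (2 ℕ.^ M) {{ℕP.m^n≢0 2 M}}
  cross : suc M ℕ.* C ℕ.* D ℕ.≤ 1 ℕ.* 2 ℕ.^ M
  cross = subst₂ ℕ._≤_ (sym (ℕP.*-assoc (suc M) C D)) (sym (ℕP.*-identityˡ (2 ℕ.^ M))) growth

-- Formally Δ = z (1 - r S) with S the shift, so
-- Δ⁻² = r² Σ_k (k+1) rᵏ Sᵏ; the finite version below carries an explicit remainder.

module SecondDifference (z r : ℚ) (z*r≡1 : z * r ≡ 1ℚ) where

  Δ : (ℕ → ℚ) → ℕ → ℚ
  Δ g k = z * g k - g (suc k)

  Δ²-linear : ∀ g g' c k → Δ (Δ (λ j → g j + c * g' j)) k ≡ Δ (Δ g) k + c * Δ (Δ g') k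
  Δ²-linear g g' c k =
    solve 8 (λ z c a₀ a₁ a₂ b₀ b₁ b₂ →
                 z :* (z :* (a₀ :+ c :* b₀) :- (a₁ :+ c :* b₁)) :- (z :* (a₁ :+ c :* b₁) :- (a₂ :+ c :* b₂))
              := (z :* (z :* a₀ :- a₁) :- (z :* a₁ :- a₂)) :+ c :* (z :* (z :* b₀ :- b₁) :- (z :* b₁ :- b₂)))
            refl z c (g k) (g (suc k)) (g (suc (suc k))) (g' k) (g' (suc k)) (g' (suc (suc k)))

  Δ²-constant : ∀ k → Δ (Δ (λ _ → 1ℚ)) k ≡ (z - 1ℚ) * (z - 1ℚ)
  Δ²-constant k = solve 1 (λ z → z :* (z :* con 1ℚ :- con 1ℚ) :- (z :* con 1ℚ :- con 1ℚ) := (z :- con 1ℚ) :* (z :- con 1ℚ)) refl z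

  -- the coefficients (k+1) r^{k+2} of Δ⁻²
  weight : ℕ → ℚ
  weight k = fromℕ (suc k) * pow r (suc (suc k))

  remainder : (ℕ → ℚ) → ℕ → ℚ
  remainder g M = fromℕ (suc M) * pow r M * g M - fromℕ M * pow r (suc M) * g (suc M)

  -- One step of the inversion.  Since (Δ²g)(M) = z² g(M) - 2z g(M+1) + g(M+2), the product
  -- weight M · (Δ²g)(M) only involves z through z r = 1; the g(M+2) terms then cancel.
  remainder-step : ∀ g M → weight M * Δ (Δ g) M + remainder g (suc M) ≡ remainder g M
  remainder-step g M = expand (fromℕ (suc M)) (fromℕ (suc (suc M))) (fromℕ-suc M) (fromℕ-suc (suc M))
    where
    open ≡-Reasoning
    R L g₀ g₁ g₂ : ℚ
    R = pow r M
    L = fromℕ M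
    g₀ = g M
    g₁ = g (suc M)
    g₂ = g (suc (suc M))
    -- the left-hand side as a polynomial in u = z r
    E : ℚ → ℚ
    E u = (1ℚ + L) * R * (u * u * g₀ - (1ℚ + 1ℚ) * u * r * g₁ + r * r * g₂)
          + ((1ℚ + (1ℚ + L)) * R * r * g₁ - (1ℚ + L) * R * r * r * g₂)
    expand : ∀ L₁ L₂ → L₁ ≡ 1ℚ + L → L₂ ≡ 1ℚ + L₁ →
             L₁ * (R * r * r) * (z * (z * g₀ - g₁) - (z * g₁ - g₂)) + (L₂ * (R * r) * g₁ - L₁ * (R * r * r) * g₂)
             ≡ L₁ * R * g₀ - L * (R * r) * g₁
    expand _ _ refl refl = begin
      _      ≡⟨ solve 7 (λ R L g₀ g₁ g₂ r z →
                          (con 1ℚ :+ L) :* (R :* r :* r) :* (z :* (z :* g₀ :- g₁) :- (z :* g₁ :- g₂))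
                            :+ ((con 1ℚ :+ (con 1ℚ :+ L)) :* (R :* r) :* g₁ :- (con 1ℚ :+ L) :* (R :* r :* r) :* g₂)
                       := (con 1ℚ :+ L) :* R :* ((z :* r) :* (z :* r) :* g₀ :- (con 1ℚ :+ con 1ℚ) :* (z :* r) :* r :* g₁ :+ r :* r :* g₂)
                            :+ ((con 1ℚ :+ (con 1ℚ :+ L)) :* R :* r :* g₁ :- (con 1ℚ :+ L) :* R :* r :* r :* g₂))
                       refl R L g₀ g₁ g₂ r z ⟩
      E (z * r) ≡⟨ cong E z*r≡1 ⟩
      E 1ℚ   ≡⟨ solve 6 (λ R L g₀ g₁ g₂ r →
                          (con 1ℚ :+ L) :* R :* (con 1ℚ :* con 1ℚ :* g₀ :- (con 1ℚ :+ con 1ℚ) :* con 1ℚ :* r :* g₁ :+ r :* r :* g₂)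
                            :+ ((con 1ℚ :+ (con 1ℚ :+ L)) :* R :* r :* g₁ :- (con 1ℚ :+ L) :* R :* r :* r :* g₂)
                       := (con 1ℚ :+ L) :* R :* g₀ :- L :* (R :* r) :* g₁)
                       refl R L g₀ g₁ g₂ r ⟩
      _      ∎

  inversion : ∀ g M → g 0 ≡ sumTo (λ k → weight k * Δ (Δ g) k) M + remainder g M
  inversion g zero = solve 3 (λ g₀ g₁ r → g₀ := con 0ℚ :+ (con 1ℚ :* con 1ℚ :* g₀ :- con 0ℚ :* (con 1ℚ :* r) :* g₁)) refl (g 0) (g 1) r
  inversion g (suc M) = begin
    g 0                                       ≡⟨ inversion g M ⟩
    S + remainder g M                         ≡⟨ cong (_+_ S) (sym (remainder-step g M)) ⟩
    S + (weight M * Δ (Δ g) M + remainder g (suc M))  ≡⟨ sym (+-assoc S _ _) ⟩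
    S + weight M * Δ (Δ g) M + remainder g (suc M)    ∎
    where
    open ≡-Reasoning
    S : ℚ
    S = sumTo (λ k → weight k * Δ (Δ g) k) M

  module Estimates (0≤r : 0ℚ ≤ r) (r≤1 : r ≤ 1ℚ) where

    weight-nonneg : ∀ k → 0ℚ ≤ weight k
    weight-nonneg k = *-nonneg (fromℕ-nonneg (suc k)) (pow-nonneg 0≤r (suc (suc k)))

    remainder-bound : ∀ {g B} → (∀ j → ∣ g j ∣ ≤ B) → ∀ M → ∣ remainder g M ∣ ≤ fromℕ (suc M) * pow r M * (B + B)
    remainder-bound {g} {B} ∣g∣≤B M = begin
      ∣ remainder g M ∣                           ≤⟨ ∣-∣-≤ (∣scale∣-≤ (*-nonneg (fromℕ-nonneg (suc M)) (pow-nonneg 0≤r M)) (∣g∣≤B M))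
                                                          (∣scale∣-≤ (*-nonneg (fromℕ-nonneg M) (pow-nonneg 0≤r (suc M))) (∣g∣≤B (suc M))) ⟩
      A * B + fromℕ M * pow r (suc M) * B         ≤⟨ +-monoʳ-≤ (A * B) (*-monoʳ-≤ B 0≤B (pow-shift-≤ 0≤r r≤1 M)) ⟩
      A * B + A * B                               ≡⟨ sym (*-distribˡ-+ A B B) ⟩
      A * (B + B)                                 ∎
      where
      open ≤-Reasoning
      A : ℚ
      A = fromℕ (suc M) * pow r M
      0≤B : 0ℚ ≤ B
      0≤B = ≤-trans (0≤∣p∣ (g 0)) (∣g∣≤B 0)

    -- Applying the inversion to the constant sequence shows that the weights sum to at most 1.
    weights-≤1 : 1ℚ ≤ (z - 1ℚ) * (z - 1ℚ) → ∀ M → sumTo weight M ≤ 1ℚ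
    weights-≤1 1≤c M = begin
      S                                           ≡⟨ sym (*-identityʳ S) ⟩
      S * 1ℚ                                      ≤⟨ *-monoˡ-≤ S (sumTo-nonneg weight-nonneg M) 1≤c ⟩
      S * c                                       ≤⟨ p≤p+q (S * c) remainder₁-nonneg ⟩
      S * c + remainder (λ _ → 1ℚ) M              ≡⟨ cong (_+ remainder (λ _ → 1ℚ) M) (sym weighted-sum) ⟩
      sumTo (λ k → weight k * Δ (Δ (λ _ → 1ℚ)) k) M + remainder (λ _ → 1ℚ) M  ≡⟨ sym (inversion (λ _ → 1ℚ) M) ⟩
      1ℚ                                          ∎
      where
      open ≤-Reasoning
      S c : ℚ
      S = sumTo weight M
      c = (z - 1ℚ) * (z - 1ℚ)
      weighted-sum : sumTo (λ k → weight k * Δ (Δ (λ _ → 1ℚ)) k) M ≡ S * c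
      weighted-sum = trans (sumTo-cong (λ k → cong (weight k *_) (Δ²-constant k)) M) (sumTo-*ʳ weight c M)
      remainder₁-nonneg : 0ℚ ≤ remainder (λ _ → 1ℚ) M
      remainder₁-nonneg = q≤p⇒0≤p-q (*-monoʳ-≤ 1ℚ (inv-nonneg 1) (pow-shift-≤ 0≤r r≤1 M))

module Series (m' : ℕ) where

  m : ℕ
  m = suc m'

  z : ℚ
  z = fromℕ (suc m)

  r : ℚ
  r = inv (suc m)

  z*r≡1 : z * r ≡ 1ℚ
  z*r≡1 = fromℕ*inv (suc m)

  open SecondDifference z r z*r≡1 public

  f : ℕ → ℚ
  f n = invFact (n ℕ.+ m)

  h : ℕ → ℚ
  h n = harmonic (n ℕ.+ m) - harmonic m'

  K : ℚ
  K = invFact m'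

  F : ℚ
  F = invFact (suc m)

  f-suc : ∀ N → f N ≡ fromℕ (suc (N ℕ.+ m)) * f (suc N)
  f-suc N = invFact-suc (N ℕ.+ m)

  K≡m*f0 : K ≡ fromℕ m * f 0
  K≡m*f0 = invFact-suc m'

  K≡ : K ≡ fromℕ m * (z * F)
  K≡ = trans K≡m*f0 (cong (fromℕ m *_) (invFact-suc m))

  -- Since h(N+1) = h N + 1/(N+1+m), the products h n · (n+m) f(n) telescope against f.
  h*f-suc : ∀ N → h (suc N) * (fromℕ (suc N ℕ.+ m) * f (suc N)) ≡ h N * f N + f (suc N)
  h*f-suc N = begin
    ((H + u) - H₀) * (P * g)          ≡⟨ solve 5 (λ H u H₀ P g → ((H :+ u) :- H₀) :* (P :* g) := (H :- H₀) :* (P :* g) :+ (P :* u) :* g) refl H u H₀ P g ⟩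
    h N * (P * g) + (P * u) * g       ≡⟨ cong₂ (λ x y → h N * x + y * g) (sym (f-suc N)) (fromℕ*inv (suc (N ℕ.+ m))) ⟩
    h N * f N + 1ℚ * g                ≡⟨ cong (_+_ (h N * f N)) (*-identityˡ g) ⟩
    h N * f N + g                     ∎
    where
    open ≡-Reasoning
    H H₀ u P g : ℚ
    H = harmonic (N ℕ.+ m)
    H₀ = harmonic m'
    u = inv (suc (N ℕ.+ m))
    P = fromℕ (suc (N ℕ.+ m))
    g = f (suc N)

  h*f-zero : h 0 * (fromℕ m * f 0) ≡ f 0
  h*f-zero = begin
    ((H₀ + u) - H₀) * (fromℕ m * f 0)  ≡⟨ solve 4 (λ H u M F → ((H :+ u) :- H) :* (M :* F) := (M :* u) :* F) refl H₀ u (fromℕ m) (f 0) ⟩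
    (fromℕ m * u) * f 0                ≡⟨ cong (_* f 0) (fromℕ*inv m) ⟩
    1ℚ * f 0                           ≡⟨ *-identityˡ (f 0) ⟩
    f 0                                ∎
    where
    open ≡-Reasoning
    H₀ u : ℚ
    H₀ = harmonic m'
    u = inv m

  Δμ : ∀ n k → Δ (μ n) k ≡ fromℕ (n ℕ.+ m) * μ n k - μ (suc n) k
  Δμ n k = begin
    z * a - b                                      ≡⟨ cong (λ u → u * a - b) (fromℕ-suc m) ⟩
    (1ℚ + fromℕ m) * a - b                         ≡⟨ solve 4 (λ M N a b → (con 1ℚ :+ M) :* a :- b := (N :+ M) :* a :- ((N :- con 1ℚ) :* a :+ b)) refl (fromℕ m) (fromℕ n) a b ⟩
    (fromℕ n + fromℕ m) * a - ((fromℕ n - 1ℚ) * a + b)  ≡⟨ cong₂ (λ u v → u * a - v) (sym (fromℕ-+ n m)) (sym (μ-suc n k)) ⟩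
    fromℕ (n ℕ.+ m) * a - μ (suc n) k              ∎
    where
    open ≡-Reasoning
    a b : ℚ
    a = μ n k
    b = μ n (suc k)

  Δ²μ : ∀ n k → Δ (Δ (μ n)) k ≡ fromℕ (n ℕ.+ m) * Δ (μ n) k - Δ (μ (suc n)) k
  Δ²μ n k = begin
    z * Δ (μ n) k - Δ (μ n) (suc k)      ≡⟨ cong₂ (λ u v → z * u - v) (Δμ n k) (Δμ n (suc k)) ⟩
    z * (Q * a₀ - b₀) - (Q * a₁ - b₁)   ≡⟨ solve 6 (λ z Q a₀ b₀ a₁ b₁ → z :* (Q :* a₀ :- b₀) :- (Q :* a₁ :- b₁) := Q :* (z :* a₀ :- a₁) :- (z :* b₀ :- b₁)) refl z Q a₀ b₀ a₁ b₁ ⟩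
    Q * (z * a₀ - a₁) - (z * b₀ - b₁)   ∎
    where
    open ≡-Reasoning
    Q a₀ a₁ b₀ b₁ : ℚ
    Q = fromℕ (n ℕ.+ m)
    a₀ = μ n k
    a₁ = μ n (suc k)
    b₀ = μ (suc n) k
    b₁ = μ (suc n) (suc k)

  α : ℕ → ℕ → ℚ
  α zero k = 0ℚ
  α (suc N) k = α N k + h N * f N * μ N k

  α-partialSum : ∀ N → α N 0 ≡ partialSum m N
  α-partialSum zero = refl
  α-partialSum (suc N) = cong₂ _+_ (α-partialSum N) (trans (cong (h N * f N *_) (sym (sign*cauchy N)))
    (solve 4 (λ h f s c → h :* f :* (s :* c) := s :* c :* h :* f) refl (h N) (f N) (sign N) (cauchy N)))

  e : ℕ → ℕ → ℚ
  e N k = f N * μ (suc N) k + h N * (fromℕ (N ℕ.+ m) * f N) * Δ (μ N) k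

  e-zero : ∀ k → e 0 k ≡ K * μ 0 k
  e-zero k = begin
    f₀ * μ₁ + h 0 * (fromℕ m * f₀) * Δ (μ 0) k   ≡⟨ cong₂ (λ x y → f₀ * μ₁ + x * y) h*f-zero (Δμ 0 k) ⟩
    f₀ * μ₁ + f₀ * (fromℕ m * μ₀ - μ₁)           ≡⟨ solve 4 (λ f M a b → f :* b :+ f :* (M :* a :- b) := M :* f :* a) refl f₀ (fromℕ m) μ₀ μ₁ ⟩
    fromℕ m * f₀ * μ₀                             ≡⟨ cong (_* μ₀) (sym K≡m*f0) ⟩
    K * μ₀                                        ∎
    where
    open ≡-Reasoning
    f₀ μ₀ μ₁ : ℚ
    f₀ = f 0
    μ₀ = μ 0 k
    μ₁ = μ 1 k

  f-telescoping : ∀ N k → f (suc N) * (μ (suc (suc N)) k + Δ (μ (suc N)) k) ≡ f N * μ (suc N) k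
  f-telescoping N k = begin
    f₁ * (μ₂ + Δ (μ (suc N)) k)   ≡⟨ cong (λ x → f₁ * (μ₂ + x)) (Δμ (suc N) k) ⟩
    f₁ * (μ₂ + (P * μ₁ - μ₂))     ≡⟨ solve 4 (λ f P a b → f :* (b :+ (P :* a :- b)) := P :* f :* a) refl f₁ P μ₁ μ₂ ⟩
    P * f₁ * μ₁                   ≡⟨ cong (_* μ₁) (sym (f-suc N)) ⟩
    f N * μ₁                      ∎
    where
    open ≡-Reasoning
    f₁ P μ₁ μ₂ : ℚ
    f₁ = f (suc N)
    P = fromℕ (suc (N ℕ.+ m))
    μ₁ = μ (suc N) k
    μ₂ = μ (suc (suc N)) k

  e-step : ∀ N k → e N k - e (suc N) k ≡ h N * f N * Δ (Δ (μ N)) k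
  e-step N k = begin
    e N k - (f₁ * μ₂ + h (suc N) * (P * f₁) * a₁)                 ≡⟨ cong (λ x → e N k - (f₁ * μ₂ + x * a₁)) (h*f-suc N) ⟩
    f₀ * μ₁ + h N * (Q * f₀) * a₀ - (f₁ * μ₂ + (h N * f₀ + f₁) * a₁)
      ≡⟨ solve 9 (λ f₀ f₁ μ₁ μ₂ hN Q a₀ a₁ x → f₀ :* μ₁ :+ hN :* (Q :* f₀) :* a₀ :- (f₁ :* μ₂ :+ (hN :* f₀ :+ f₁) :* a₁)
                                            := hN :* f₀ :* (Q :* a₀ :- a₁) :+ (f₀ :* μ₁ :- f₁ :* (μ₂ :+ a₁)))
                 refl f₀ f₁ μ₁ μ₂ (h N) Q a₀ a₁ 0ℚ ⟩
    h N * f₀ * (Q * a₀ - a₁) + (f₀ * μ₁ - f₁ * (μ₂ + a₁))         ≡⟨ cong₂ (λ x y → h N * f₀ * x + (f₀ * μ₁ - y)) (sym (Δ²μ N k)) (f-telescoping N k) ⟩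
    h N * f₀ * Δ (Δ (μ N)) k + (f₀ * μ₁ - f₀ * μ₁)                ≡⟨ cong (_+_ (h N * f₀ * Δ (Δ (μ N)) k)) (+-inverseʳ (f₀ * μ₁)) ⟩
    h N * f₀ * Δ (Δ (μ N)) k + 0ℚ                                 ≡⟨ +-identityʳ _ ⟩
    h N * f₀ * Δ (Δ (μ N)) k                                      ∎
    where
    open ≡-Reasoning
    f₀ f₁ P Q μ₁ μ₂ a₀ a₁ : ℚ
    f₀ = f N
    f₁ = f (suc N)
    P = fromℕ (suc (N ℕ.+ m))
    Q = fromℕ (N ℕ.+ m)
    μ₁ = μ (suc N) k
    μ₂ = μ (suc (suc N)) k
    a₀ = Δ (μ N) k
    a₁ = Δ (μ (suc N)) k

  Δ²α : ∀ N k → Δ (Δ (α N)) k ≡ K * μ 0 k - e N k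
  Δ²α zero k = begin
    z * (z * 0ℚ - 0ℚ) - (z * 0ℚ - 0ℚ)   ≡⟨ solve 1 (λ z → z :* (z :* con 0ℚ :- con 0ℚ) :- (z :* con 0ℚ :- con 0ℚ) := con 0ℚ) refl z ⟩
    0ℚ                                  ≡⟨ sym (+-inverseʳ (K * μ 0 k)) ⟩
    K * μ 0 k - K * μ 0 k               ≡⟨ cong (λ x → K * μ 0 k - x) (sym (e-zero k)) ⟩
    K * μ 0 k - e 0 k                   ∎
    where open ≡-Reasoning
  Δ²α (suc N) k = begin
    Δ (Δ (α (suc N))) k                                     ≡⟨ Δ²-linear (α N) (μ N) (h N * f N) k ⟩
    Δ (Δ (α N)) k + h N * f N * Δ (Δ (μ N)) k               ≡⟨ cong₂ _+_ (Δ²α N k) (sym (e-step N k)) ⟩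
    (K * μ 0 k - e N k) + (e N k - e (suc N) k)             ≡⟨ solve 3 (λ a b c → (a :- b) :+ (b :- c) := a :- c) refl (K * μ 0 k) (e N k) (e (suc N) k) ⟩
    K * μ 0 k - e (suc N) k                                 ∎
    where open ≡-Reasoning

  K*r² : K * (r * r) ≡ F * (1ℚ - r)
  K*r² = begin
    K * (r * r)                           ≡⟨ cong (_* (r * r)) K≡ ⟩
    fromℕ m * (z * F) * (r * r)           ≡⟨ solve 4 (λ M z F r → M :* (z :* F) :* (r :* r) := M :* F :* r :* (z :* r)) refl (fromℕ m) z F r ⟩
    fromℕ m * F * r * (z * r)             ≡⟨ cong (fromℕ m * F * r *_) z*r≡1 ⟩
    fromℕ m * F * r * 1ℚ                  ≡⟨ solve 3 (λ M F r → M :* F :* r :* con 1ℚ := F :* ((con 1ℚ :+ M) :* r :- r)) refl (fromℕ m) F r ⟩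
    F * ((1ℚ + fromℕ m) * r - r)          ≡⟨ cong (λ x → F * (x * r - r)) (sym (fromℕ-suc m)) ⟩
    F * (z * r - r)                       ≡⟨ cong (λ x → F * (x - r)) z*r≡1 ⟩
    F * (1ℚ - r)                          ∎
    where open ≡-Reasoning

  weighted-K-term : ∀ k → weight k * (K * μ 0 k) ≡ F * pow r k - F * pow r (suc k)
  weighted-K-term k = begin
    fromℕ (suc k) * (R * r * r) * (K * μ 0 k)            ≡⟨ cong (λ x → fromℕ (suc k) * (R * r * r) * (K * x)) (μ-zero k) ⟩
    fromℕ (suc k) * (R * r * r) * (K * inv (suc k))      ≡⟨ solve 5 (λ A R r K i → A :* (R :* r :* r) :* (K :* i) := R :* (K :* (r :* r)) :* (A :* i)) refl (fromℕ (suc k)) R r K (inv (suc k)) ⟩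
    R * (K * (r * r)) * (fromℕ (suc k) * inv (suc k))    ≡⟨ cong₂ (λ x y → R * x * y) K*r² (fromℕ*inv (suc k)) ⟩
    R * (F * (1ℚ - r)) * 1ℚ                              ≡⟨ solve 3 (λ R F r → R :* (F :* (con 1ℚ :- r)) :* con 1ℚ := F :* R :- F :* (R :* r)) refl R F r ⟩
    F * R - F * (R * r)                                  ∎
    where
    open ≡-Reasoning
    R : ℚ
    R = pow r k

  weighted-K-sum : ∀ M → sumTo (λ k → weight k * (K * μ 0 k)) M ≡ F - F * pow r M
  weighted-K-sum M = trans (sumTo-cong weighted-K-term M)
    (trans (sumTo-telescope (λ k → F * pow r k) M) (cong (_- F * pow r M) (*-identityʳ F)))

  partial-sum-error : ∀ N M → α N 0 - F ≡ remainder (α N) M - F * pow r M - sumTo (λ k → weight k * e N k) M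
  partial-sum-error N M = begin
    α N 0 - F                                                  ≡⟨ cong (_- F) (inversion (α N) M) ⟩
    sumTo (λ k → weight k * Δ (Δ (α N)) k) M + T - F           ≡⟨ cong (λ x → x + T - F) (sumTo-cong distribute M) ⟩
    sumTo (λ k → weight k * (K * μ 0 k) - weight k * e N k) M + T - F
                                                               ≡⟨ cong (λ x → x + T - F) (sumTo-sub _ (λ k → weight k * e N k) M) ⟩
    (sumTo (λ k → weight k * (K * μ 0 k)) M - S) + T - F       ≡⟨ cong (λ x → (x - S) + T - F) (weighted-K-sum M) ⟩
    ((F - F * pow r M) - S) + T - F                            ≡⟨ solve 4 (λ F P S T → ((F :- P) :- S) :+ T :- F := T :- P :- S) refl F (F * pow r M) S T ⟩
    T - F * pow r M - S                                        ∎
    where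
    open ≡-Reasoning
    T S : ℚ
    T = remainder (α N) M
    S = sumTo (λ k → weight k * e N k) M
    distribute : ∀ k → weight k * Δ (Δ (α N)) k ≡ weight k * (K * μ 0 k) - weight k * e N k
    distribute k = trans (cong (weight k *_) (Δ²α N k))
      (solve 3 (λ w a b → w :* (a :- b) := w :* a :- w :* b) refl (weight k) (K * μ 0 k) (e N k))

-- Harmonic numbers: monotone, and Hₙ ≤ k + n/(k+1) for every k (the first k terms are
-- at most 1, the others at most 1/(k+1)); hence Hₙ/n → 0.

harmonic-mono : ∀ {a b} → a ℕ.≤ b → harmonic a ≤ harmonic b
harmonic-mono a≤b = mono′ (ℕP.≤⇒≤′ a≤b)
  where
  mono′ : ∀ {a b} → a ℕ.≤′ b → harmonic a ≤ harmonic b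
  mono′ ℕ.≤′-refl = ≤-refl
  mono′ {b = suc b} (ℕ.≤′-step a≤′b) = ≤-trans (mono′ a≤′b) (p≤p+q (harmonic b) (inv-nonneg (suc b)))

harmonic-nonneg : ∀ n → 0ℚ ≤ harmonic n
harmonic-nonneg n = harmonic-mono {0} {n} ℕ.z≤n

harmonic-≤-n : ∀ n → harmonic n ≤ fromℕ n
harmonic-≤-n zero = ≤-refl
harmonic-≤-n (suc n) = ≤-trans (+-mono-≤ (harmonic-≤-n n) (inv-≤1 n))
                               (≤-reflexive (trans (+-comm (fromℕ n) 1ℚ) (sym (fromℕ-suc n))))

harmonic-bound : ∀ k n → harmonic n ≤ fromℕ k + fromℕ n * inv (suc k)
harmonic-bound k zero = +-nonneg (fromℕ-nonneg k) (*-nonneg (fromℕ-nonneg 0) (inv-nonneg (suc k)))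
harmonic-bound k (suc n) with suc n ℕ.≤? k
... | yes n<k = ≤-trans (harmonic-≤-n (suc n))
                  (≤-trans (fromℕ-mono-≤ n<k) (p≤p+q (fromℕ k) (*-nonneg (fromℕ-nonneg (suc n)) (inv-nonneg (suc k)))))
... | no n≮k = begin
  harmonic n + inv (suc n)                 ≤⟨ +-mono-≤ (harmonic-bound k n) (inv-antitone (ℕ.s≤s (ℕP.≮⇒≥ n≮k))) ⟩
  fromℕ k + fromℕ n * w + w                ≡⟨ solve 3 (λ K N w → K :+ N :* w :+ w := K :+ (con 1ℚ :+ N) :* w) refl (fromℕ k) (fromℕ n) w ⟩
  fromℕ k + (1ℚ + fromℕ n) * w             ≡⟨ cong (λ x → fromℕ k + x * w) (sym (fromℕ-suc n)) ⟩
  fromℕ k + fromℕ (suc n) * w              ∎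
  where
  open ≤-Reasoning
  w : ℚ
  w = inv (suc k)

-- (1 + A H_{n+1+m}) / (n+1) → 0: choose k with A/(k+1) small, then n large.
harmonic-ratio-vanishes : ∀ A m → TendsToZero (λ n → (1ℚ + fromℕ A * harmonic (suc n ℕ.+ m)) * inv (suc n))
harmonic-ratio-vanishes A m D = N , bound
  where
  Q : ℕ
  Q = 2 ℕ.* D
  instance
    Q≢0 : ℕ.NonZero Q
    Q≢0 = ℕP.m*n≢0 2 D
  k N : ℕ
  k = A ℕ.* (2 ℕ.* Q)
  N = (1 ℕ.+ A ℕ.* k) ℕ.* Q ℕ.+ m

  -- the first k harmonic terms, divided by n+1
  few-terms : ∀ n → N ℕ.≤ n → (1 ℕ.+ A ℕ.* k) ℕ.* Q ℕ.≤ 1 ℕ.* suc n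
  few-terms n N≤n = ℕP.≤-trans (ℕP.m≤m+n _ m) (ℕP.≤-trans N≤n (ℕP.≤-trans (ℕP.n≤1+n n) (ℕP.≤-reflexive (sym (ℕP.*-identityˡ (suc n))))))

  -- the remaining terms, each at most 1/(k+1)
  many-terms : ∀ n → N ℕ.≤ n → A ℕ.* (suc n ℕ.+ m) ℕ.* Q ℕ.≤ 1 ℕ.* (suc k ℕ.* suc n)
  many-terms n N≤n = begin
    A ℕ.* (suc n ℕ.+ m) ℕ.* Q       ≤⟨ ℕP.*-monoˡ-≤ Q (ℕP.*-monoʳ-≤ A (ℕP.+-monoʳ-≤ (suc n) m≤n+1)) ⟩
    A ℕ.* (suc n ℕ.+ suc n) ℕ.* Q   ≡⟨ regroup A (suc n) Q ⟩
    k ℕ.* suc n                     ≤⟨ ℕP.*-monoˡ-≤ (suc n) (ℕP.n≤1+n k) ⟩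
    suc k ℕ.* suc n                 ≡⟨ sym (ℕP.*-identityˡ _) ⟩
    1 ℕ.* (suc k ℕ.* suc n)         ∎
    where
    open ℕP.≤-Reasoning
    m≤n+1 : m ℕ.≤ suc n
    m≤n+1 = ℕP.≤-trans (ℕP.m≤n+m m _) (ℕP.≤-trans N≤n (ℕP.n≤1+n n))
    regroup : ∀ a x q → a ℕ.* (x ℕ.+ x) ℕ.* q ≡ a ℕ.* (2 ℕ.* q) ℕ.* x
    regroup = solve-∀

  bound : ∀ n → N ℕ.≤ n → (1ℚ + fromℕ A * harmonic (suc n ℕ.+ m)) * inv (suc n) ≤ inv D
  bound n N≤n = begin
    (1ℚ + a * harmonic X) * i                    ≤⟨ *-monoʳ-≤ i (inv-nonneg (suc n)) (+-monoʳ-≤ 1ℚ (*-monoˡ-≤ a (fromℕ-nonneg A) (harmonic-bound k X))) ⟩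
    (1ℚ + a * (fromℕ k + fromℕ X * w)) * i       ≡⟨ solve 5 (λ a K X w i → (con 1ℚ :+ a :* (K :+ X :* w)) :* i := (con 1ℚ :+ a :* K) :* i :+ (a :* X) :* (w :* i)) refl a (fromℕ k) (fromℕ X) w i ⟩
    (1ℚ + a * fromℕ k) * i + (a * fromℕ X) * (w * i)
                                                 ≡⟨ cong₂ (λ x y → x * i + y) (sym (trans (fromℕ-suc (A ℕ.* k)) (cong (_+_ 1ℚ) (fromℕ-* A k))))
                                                                              (cong₂ _*_ (sym (fromℕ-* A X)) (sym (inv-* (suc k) (suc n)))) ⟩
    fromℕ (1 ℕ.+ A ℕ.* k) * i + fromℕ (A ℕ.* X) * inv (suc k ℕ.* suc n)
                                                 ≤⟨ +-mono-≤ (fraction-≤ (1 ℕ.+ A ℕ.* k) (suc n) 1 Q (few-terms n N≤n))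
                                                             (fraction-≤ (A ℕ.* X) (suc k ℕ.* suc n) 1 Q (many-terms n N≤n)) ⟩
    fromℕ 1 * inv Q + fromℕ 1 * inv Q           ≡⟨ cong₂ _+_ (*-identityˡ (inv Q)) (*-identityˡ (inv Q)) ⟩
    inv Q + inv Q                                ≡⟨ inv-half D ⟩
    inv D                                        ∎
    where
    open ≤-Reasoning
    X : ℕ
    a i w : ℚ
    X = suc n ℕ.+ m
    a = fromℕ A
    i = inv (suc n)
    w = inv (suc k)

G : ℕ → ℚ
G zero = 1ℚ
G (suc n) = fromℕ (n !)

G-nonneg : ∀ n → 0ℚ ≤ G n
G-nonneg zero = inv-nonneg 1
G-nonneg (suc n) = fromℕ-nonneg (n !)

μ-zero-nonneg : ∀ k → 0ℚ ≤ μ 0 k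
μ-zero-nonneg k = subst (0ℚ ≤_) (sym (μ-zero k)) (inv-nonneg (suc k))

μ-zero-≤1 : ∀ k → μ 0 k ≤ 1ℚ
μ-zero-≤1 k = subst (_≤ 1ℚ) (sym (μ-zero k)) (inv-≤1 k)

-- Rₙ₊₂(t) = n Rₙ₊₁(t) + (1-t) Rₙ₊₁(t): for n ≥ 1 both coefficients of the recursion are nonnegative.
μ-suc-suc : ∀ n k → μ (suc (suc n)) k ≡ fromℕ n * μ (suc n) k + μ (suc n) (suc k)
μ-suc-suc n k = begin
  μ (suc (suc n)) k                                        ≡⟨ μ-suc (suc n) k ⟩
  (fromℕ (suc n) - 1ℚ) * μ (suc n) k + μ (suc n) (suc k)   ≡⟨ cong (λ x → (x - 1ℚ) * μ (suc n) k + μ (suc n) (suc k)) (fromℕ-suc n) ⟩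
  (1ℚ + fromℕ n - 1ℚ) * μ (suc n) k + μ (suc n) (suc k)    ≡⟨ solve 3 (λ N a b → (con 1ℚ :+ N :- con 1ℚ) :* a :+ b := N :* a :+ b) refl (fromℕ n) (μ (suc n) k) (μ (suc n) (suc k)) ⟩
  fromℕ n * μ (suc n) k + μ (suc n) (suc k)                ∎
  where open ≡-Reasoning

μ-bound : ∀ n k → ∣ μ n k ∣ ≤ G n
μ-bound zero k = subst (_≤ 1ℚ) (sym (0≤p⇒∣p∣≡p (μ-zero-nonneg k))) (μ-zero-≤1 k)
μ-bound (suc zero) k = subst (λ x → ∣ x ∣ ≤ 1ℚ) (sym μ₁≡)
  (∣-∣-unit (μ-zero-nonneg k) (μ-zero-≤1 k) (μ-zero-nonneg (suc k)) (μ-zero-≤1 (suc k)))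
  where
  μ₁≡ : μ 1 k ≡ μ 0 (suc k) - μ 0 k
  μ₁≡ = trans (μ-suc 0 k) (solve 2 (λ a b → (con 0ℚ :- con 1ℚ) :* a :+ b := b :- a) refl (μ 0 k) (μ 0 (suc k)))
μ-bound (suc (suc n)) k = begin
  ∣ μ (suc (suc n)) k ∣                            ≡⟨ cong ∣_∣ (μ-suc-suc n k) ⟩
  ∣ fromℕ n * μ (suc n) k + μ (suc n) (suc k) ∣    ≤⟨ ∣+∣-≤ (∣scale∣-≤ (fromℕ-nonneg n) (μ-bound (suc n) k)) (μ-bound (suc n) (suc k)) ⟩
  fromℕ n * fromℕ (n !) + fromℕ (n !)              ≡⟨ +-comm (fromℕ n * fromℕ (n !)) (fromℕ (n !)) ⟩
  fromℕ (n !) + fromℕ n * fromℕ (n !)              ≡⟨ cong (_+_ (fromℕ (n !))) (sym (fromℕ-* n (n !))) ⟩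
  fromℕ (n !) + fromℕ (n ℕ.* n !)                  ≡⟨ sym (fromℕ-+ (n !) (n ℕ.* n !)) ⟩
  fromℕ (suc n !)                                  ∎
  where open ≤-Reasoning

module SeriesBounds (m' : ℕ) where
  open Series m'
  open Estimates (inv-nonneg (suc m)) (inv-≤1 m)

  f-nonneg : ∀ n → 0ℚ ≤ f n
  f-nonneg n = invFact-nonneg (n ℕ.+ m)

  h-nonneg : ∀ n → 0ℚ ≤ h n
  h-nonneg n = q≤p⇒0≤p-q (harmonic-mono (ℕP.≤-trans (ℕP.n≤1+n m') (ℕP.m≤n+m m n)))

  z-nonneg : 0ℚ ≤ z
  z-nonneg = fromℕ-nonneg (suc m)

  -- z + 1 = m + 2, needed to read the bound on EB with a natural-number constant.
  z+1≡ : z + 1ℚ ≡ fromℕ (suc (suc m))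
  z+1≡ = trans (+-comm z 1ℚ) (sym (fromℕ-suc (suc m)))

  -- (z - 1)² = m² ≥ 1, so the weights of Δ⁻² sum to at most 1.
  weights-sum-≤1 : ∀ M → sumTo weight M ≤ 1ℚ
  weights-sum-≤1 = weights-≤1 (subst (1ℚ ≤_) (sym (cong (λ x → x * x) z-1≡m)) (*-mono-≤ (inv-nonneg 1) (inv-nonneg 1) 1≤m 1≤m))
    where
    z-1≡m : z - 1ℚ ≡ fromℕ m
    z-1≡m = trans (cong (_- 1ℚ) (fromℕ-suc m)) (solve 1 (λ M → con 1ℚ :+ M :- con 1ℚ := M) refl (fromℕ m))
    1≤m : 1ℚ ≤ fromℕ m
    1≤m = fromℕ-mono-≤ {1} {m} (ℕ.s≤s ℕ.z≤n)

  B : ℕ → ℚ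
  B N = sumTo (λ n → h n * f n * G n) N

  α-bound : ∀ N j → ∣ α N j ∣ ≤ B N
  α-bound zero j = ≤-refl
  α-bound (suc N) j = ∣+∣-≤ (α-bound N j) (∣scale∣-≤ (*-nonneg (h-nonneg N) (f-nonneg N)) (μ-bound N j))

  B-nonneg : ∀ N → 0ℚ ≤ B N
  B-nonneg N = ≤-trans (0≤∣p∣ (α N 0)) (α-bound N 0)

  Δμ-bound : ∀ N k → ∣ Δ (μ N) k ∣ ≤ (z + 1ℚ) * G N
  Δμ-bound N k = subst (∣ Δ (μ N) k ∣ ≤_) (solve 2 (λ z g → z :* g :+ g := (z :+ con 1ℚ) :* g) refl z (G N))
    (∣-∣-≤ (∣scale∣-≤ z-nonneg (μ-bound N k)) (μ-bound N (suc k)))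

  EB : ℕ → ℚ
  EB N = f N * G (suc N) + h N * (fromℕ (N ℕ.+ m) * f N) * ((z + 1ℚ) * G N)

  e-bound : ∀ N k → ∣ e N k ∣ ≤ EB N
  e-bound N k = ∣+∣-≤ (∣scale∣-≤ (f-nonneg N) (μ-bound (suc N) k))
    (∣scale∣-≤ (*-nonneg (h-nonneg N) (*-nonneg (fromℕ-nonneg (N ℕ.+ m)) (f-nonneg N))) (Δμ-bound N k))

  EB-nonneg : ∀ N → 0ℚ ≤ EB N
  EB-nonneg N = ≤-trans (0≤∣p∣ (e N 0)) (e-bound N 0)

  δ : ℕ → ℕ → ℚ
  δ N M = fromℕ (suc M) * pow r M * (F + (B N + B N))

  partialSum-bound : ∀ N M → ∣ partialSum m N - F ∣ ≤ EB N + δ N M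
  partialSum-bound N M = begin
    ∣ partialSum m N - F ∣       ≡⟨ cong (λ x → ∣ x - F ∣) (sym (α-partialSum N)) ⟩
    ∣ α N 0 - F ∣                ≡⟨ cong ∣_∣ (partial-sum-error N M) ⟩
    ∣ T - F * R - S ∣            ≤⟨ ∣-∣-≤ (∣-∣-≤ (remainder-bound (α-bound N) M) geometric-term) weighted-errors ⟩
    A * (B N + B N) + A * F + EB N
                                 ≡⟨ solve 4 (λ A b F E → A :* (b :+ b) :+ A :* F :+ E := E :+ A :* (F :+ (b :+ b))) refl A (B N) F (EB N) ⟩
    EB N + δ N M                 ∎
    where
    open ≤-Reasoning
    R A T S : ℚ
    R = pow r M
    A = fromℕ (suc M) * R
    T = remainder (α N) M
    S = sumTo (λ k → weight k * e N k) M
    0≤F : 0ℚ ≤ F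
    0≤F = invFact-nonneg (suc m)
    0≤R : 0ℚ ≤ R
    0≤R = pow-nonneg (inv-nonneg (suc m)) M
    geometric-term : ∣ F * R ∣ ≤ A * F
    geometric-term = begin
      ∣ F * R ∣                ≡⟨ 0≤p⇒∣p∣≡p (*-nonneg 0≤F 0≤R) ⟩
      F * R                    ≡⟨ solve 2 (λ F R → F :* R := con 1ℚ :* R :* F) refl F R ⟩
      1ℚ * R * F               ≤⟨ *-monoʳ-≤ F 0≤F (*-monoʳ-≤ R 0≤R (fromℕ-mono-≤ {1} {suc M} (ℕ.s≤s ℕ.z≤n))) ⟩
      A * F                    ∎
    weighted-errors : ∣ S ∣ ≤ EB N
    weighted-errors = begin
      ∣ S ∣                    ≤⟨ sumTo-weighted-≤ weight-nonneg (e-bound N) M ⟩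
      sumTo weight M * EB N    ≤⟨ *-monoʳ-≤ (EB N) (EB-nonneg N) (weights-sum-≤1 M) ⟩
      1ℚ * EB N                ≡⟨ *-identityˡ (EB N) ⟩
      EB N                     ∎

  -- For fixed N, δ N M → 0 as M grows, because r = 1/(m+1) ≤ ½.
  δ-small : ∀ N → ArbitrarilySmall (δ N)
  δ-small N = linear*geometric-small (inv-nonneg (suc m)) (inv-antitone {2} {suc m} (ℕ.s≤s (ℕ.s≤s ℕ.z≤n)))
    (+-nonneg (invFact-nonneg (suc m)) (+-nonneg (B-nonneg N) (B-nonneg N)))

  -- n! / (n+m)! ≤ 1/(n+1), since m ≥ 1.
  factorial-ratio : ∀ n → f n * fromℕ (n !) ≤ inv (suc n)
  factorial-ratio n = subst₂ _≤_ (*-comm (fromℕ (n !)) (f n)) (*-identityˡ (inv (suc n)))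
    (fraction-≤ (n !) ((n ℕ.+ m) !) 1 (suc n) {{(n ℕ.+ m) ℕP.!≢0}}
      (subst₂ ℕ._≤_ (ℕP.*-comm (suc n) (n !)) (sym (ℕP.*-identityˡ _))
        (factorial-mono (subst (suc n ℕ.≤_) (sym (ℕP.+-suc n m')) (ℕ.s≤s (ℕP.m≤m+n n m'))))))

  EB-≤ : ∀ n → EB (suc n) ≤ (1ℚ + (z + 1ℚ) * harmonic (suc n ℕ.+ m)) * inv (suc n)
  EB-≤ n = begin
    f n₁ * G (suc n₁) + h n₁ * c * ((z + 1ℚ) * G n₁)   ≤⟨ +-mono-≤ first second ⟩
    i + (z + 1ℚ) * H * i                              ≡⟨ factor-out i (z + 1ℚ) H ⟩
    (1ℚ + (z + 1ℚ) * H) * i                           ∎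
    where
    open ≤-Reasoning
    n₁ : ℕ
    c H i : ℚ
    n₁ = suc n
    c = fromℕ (n₁ ℕ.+ m) * f n₁
    H = harmonic (n₁ ℕ.+ m)
    i = inv (suc n)
    0≤z+1 : 0ℚ ≤ z + 1ℚ
    0≤z+1 = +-nonneg z-nonneg (inv-nonneg 1)
    factor-out : ∀ i a H → i + a * H * i ≡ (1ℚ + a * H) * i
    factor-out = solve 3 (λ i a H → i :+ a :* H :* i := (con 1ℚ :+ a :* H) :* i) refl
    regroup : ∀ h c a g → h * c * (a * g) ≡ a * h * (c * g)
    regroup = solve 4 (λ h c a g → h :* c :* (a :* g) := a :* h :* (c :* g)) refl
    first : f n₁ * G (suc n₁) ≤ i
    first = ≤-trans (factorial-ratio n₁) (inv-antitone (ℕP.n≤1+n (suc n)))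
    c*G≤i : c * G n₁ ≤ i
    c*G≤i = subst (_≤ i) (cong (_* fromℕ (n !)) (f-suc n)) (factorial-ratio n)
    second : h n₁ * c * ((z + 1ℚ) * G n₁) ≤ (z + 1ℚ) * H * i
    second = begin
      h n₁ * c * ((z + 1ℚ) * G n₁)   ≡⟨ regroup (h n₁) c (z + 1ℚ) (G n₁) ⟩
      (z + 1ℚ) * h n₁ * (c * G n₁)   ≤⟨ *-mono-≤ (*-nonneg 0≤z+1 (h-nonneg n₁)) (*-nonneg (*-nonneg (fromℕ-nonneg (n₁ ℕ.+ m)) (f-nonneg n₁)) (G-nonneg n₁))
                                         (*-monoˡ-≤ (z + 1ℚ) 0≤z+1 (p-q≤p H (harmonic-nonneg m'))) c*G≤i ⟩
      (z + 1ℚ) * H * i               ∎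

  EB-vanishes : TendsToZero EB
  EB-vanishes D = suc N , bound
    where
    ratio-small : ∃[ N ] (∀ n → N ℕ.≤ n → (1ℚ + fromℕ (suc (suc m)) * harmonic (suc n ℕ.+ m)) * inv (suc n) ≤ inv D)
    ratio-small = harmonic-ratio-vanishes (suc (suc m)) m D
    N : ℕ
    N = proj₁ ratio-small
    bound : ∀ n → suc N ℕ.≤ n → EB n ≤ inv D
    bound (suc n) (ℕ.s≤s N≤n) = ≤-trans (EB-≤ n)
      (≤-trans (≤-reflexive (cong (λ a → (1ℚ + a * harmonic (suc n ℕ.+ m)) * inv (suc n)) z+1≡)) (proj₂ ratio-small n N≤n))

convergence-criterion : ∀ (s : ℕ → ℚ) L (a : ℕ → ℚ) (b : ℕ → ℕ → ℚ) →
                        (∀ n M → ∣ s n - L ∣ ≤ a n + b n M) →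
                        TendsToZero a → (∀ n → ArbitrarilySmall (b n)) →
                        SeriesConvergesTo s L
convergence-criterion s L a b split a→0 b-small ε 0<ε = within (unit-fraction-< ε 0<ε)
  where
  within : ∃[ d ] inv (suc d) < ε → ∃[ N ] (∀ n → N ℕ.≤ n → ∣ s n - L ∣ < ε)
  within (d , 1/d+1<ε) = proj₁ (a→0 D) , close
    where
    D : ℕ
    D = 2 ℕ.* suc d
    close : ∀ n → proj₁ (a→0 D) ℕ.≤ n → ∣ s n - L ∣ < ε
    close n N≤n = begin-strict
      ∣ s n - L ∣                  ≤⟨ split n M ⟩
      a n + b n M                  ≤⟨ +-mono-≤ (proj₂ (a→0 D) n N≤n) (proj₂ (b-small n D)) ⟩
      inv D + inv D                ≡⟨ inv-half (suc d) ⟩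
      inv (suc d)                  <⟨ 1/d+1<ε ⟩
      ε                            ∎
      where
      open ≤-Reasoning
      M : ℕ
      M = proj₁ (b-small n D)

mainTheorem4 : (m : ℕ) → 1 ℕ.≤ m → SeriesConvergesTo (partialSum m) (invFact (suc m))
mainTheorem4 zero ()
mainTheorem4 (suc m') _ =
  convergence-criterion (partialSum (suc m')) (invFact (suc (suc m'))) EB δ partialSum-bound EB-vanishes δ-small
  where open SeriesBounds m'
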